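{- Let $vs$ be a list of variables. (i) For every command $c$, $\mathrm{cFrame}(c,vs)$ implies $vs\Vdash\mathrm{uchk}(c,vs)$. (ii) For every bicom $B$, $\mathrm{biFrame}(B,vs)$ implies $vs\Vdash\mathrm{biR}(\mathrm{chk}(B,vs))$. (iii) For every bicom $B$, $\mathrm{biFrame}(B,vs)$ implies $vs\Vdash\mathrm{chk}(B,vs)$.
   Context: Variables are integer or boolean; a store is a total function from variables to values of the appropriate type; $\mathsf{Store}$ is the set of stores; $s[x\mapsto n]$ the update. Expressions are arbitrary functions on stores; assertions subsets of $\mathsf{Store}$; relations subsets of $\mathsf{Store}^2$; two-state expressions $E:\mathsf{Store}^2\to\mathbb Z$; $\exists|x.\mathcal P=\{(s,s'):(s,s'[x\mapsto v])\in\mathcal P$ for some value $v$ of $x$'s type$\}$. Commands: $c::=\mathsf{skip}\mid x:=e\mid\mathsf{hav}\ x\mid\mathsf{assert}\ p\mid c;c\mid\mathsf{if}\ e\ \mathsf{then}\ c\ \mathsf{else}\ c\mid\mathsf{while}\ e\ \mathsf{vnt}\ e_1\ \mathsf{do}\ c$ with standard big-step semantics $c/s\Downarrow\phi$, $\phi\in\mathsf{Store}\cup\{\mathsf{fail}\}$ (variant $e_1$ inert; $\mathsf{hav}\ x$ assigns any value; $\mathsf{assert}\ p$ fails outside $p$; failure propagates). Bicoms: $B::=\langle c|c'\rangle\mid\mathsf{assert}\ \mathcal P\mid\mathsf{havf}\ x\ \mathcal P\mid B;B\mid\mathsf{if}\ e|e'\ B_1B_2B_3B_4\mid\mathsf{while}\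 e|e'\ \mathsf{algn}\ \mathcal L|\mathcal R\ \mathsf{vnt}\ E\ \mathsf{do}\ B$. $\mathrm{L}$: $\langle c|c'\rangle\mapsto c$, assert/havf$\mapsto\mathsf{skip}$, homomorphic on sequence, bi-if$\mapsto\mathsf{if}\ e\ \mathsf{then}\ \mathrm{L}(B_1)\ \mathsf{else}\ \mathrm{L}(B_3)$, bi-while$\mapsto\mathsf{while}\ e\ \mathsf{do}\ \mathrm{L}(B)$; $\mathrm{biL}(B)=\langle\mathrm{L}(B)|\mathsf{skip}\rangle$; $\mathrm{biR}$: $\langle c|c'\rangle\mapsto\langle\mathsf{skip}|c'\rangle$, assert/havf unchanged, homomorphic on sequence, $\mathsf{if}\ e|e'\ B_1..B_4\mapsto\mathsf{if}\ \mathrm{tt}|e'\ \mathrm{biR}(B_1)..\mathrm{biR}(B_4)$, $\mathsf{while}\ e|e'\ \mathsf{algn}\ \mathcal L|\mathcal R\ \mathsf{vnt}\ E\ \mathsf{do}\ B\mapsto\mathsf{while}\ \mathrm{ff}|e'\ \mathsf{algn}\ \emptyset|\mathcal R\ \mathsf{vnt}\ E\ \mathsf{do}\ \mathrm{biR}(B)$. Semantics $B/(s,s')\Downarrow\varphi$: embed fails if $c/s$ fails or ($c/s\Downarrow t$ and $c'/s'$ fails), else yields $(t,t')$ for $c/s\Downarrow t$, $c'/s'\Downarrow t'$; $\mathsf{assert}\ \mathcal P$ yields $(s,s')$ if in $\mathcal P$, else fails; $\mathsf{havf}\ x\ \mathcal P$ yields $(s,s'[x\mapsto n])$ for each value $n$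 with $(s,s'[x\mapsto n])\in\mathcal P$; sequence with failure propagation; bi-if runs $B_1..B_4$ according as ($s\models e,s'\models e'$), ($s\models e,s'\not\models e'$), ($s\not\models e,s'\models e'$), (neither); bi-while $W$: stop with $(s,s')$ if $s\not\models e,s'\not\models e'$; if $s\models e$, $(s,s')\in\mathcal L$ run $\mathrm{biL}(B)$ then $W$; otherwise if $s'\models e'$, $(s,s')\in\mathcal R$ run $\mathrm{biR}(B)$ then $W$; if $s\models e,s'\models e'$, $(s,s')\notin\mathcal L\cup\mathcal R$ run $B$ then $W$ (failure propagates); fail if ($s\models e,s'\not\models e',(s,s')\notin\mathcal L$) or ($s\not\models e,s'\models e',(s,s')\notin\mathcal R$). $s=_{vs}t$ iff $s(x)=t(x)$ for $x\in vs$. $vs\Vdash e$ iff $s=_{vs}t\Rightarrow e(s)=e(t)$; $vs\Vdash p$ iff $s=_{vs}t\Rightarrow(s\in p\iff t\in p)$; $vs\Vdash E$ iff $s=_{vs}t\wedge s'=_{vs}t'\Rightarrow E(s,s')=E(t,t')$; $vs\Vdash\mathcal R$ iff $s=_{vs}t\wedge s'=_{vs}t'\Rightarrow((s,s')\in\mathcal R\iff(t,t')\in\mathcal R)$. $vs\Vdash c$ iff ($s=_{vs}s'$, $c/s\Downarrow t$ imply some $t'$ with $c/s'\Downarrow t'$, $t=_{vs}t'$) and ($s=_{vs}s'$, $c/s\Downarrow\mathsf{fail}$ imply $c/s'\Downarrow\mathsf{fail}$). $vs\Vdash B$ iff ($s=_{vs}t$, $s'=_{vs}t'$, $B/(s,s')\Downarrow(u,u')$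 imply some $(v,v')$ with $B/(t,t')\Downarrow(v,v')$, $u=_{vs}v$, $u'=_{vs}v'$) and ($s=_{vs}t$, $s'=_{vs}t'$, $B/(s,s')\Downarrow\mathsf{fail}$ imply $B/(t,t')\Downarrow\mathsf{fail}$). $\mathrm{cFrame}(c,vs)$: $\mathrm{tt}$ for skip; $x\in vs\wedge vs\Vdash e$ for $x:=e$; $x\in vs$ for $\mathsf{hav}\ x$; $vs\Vdash p$ for assert; conjunction for sequence; $vs\Vdash e$ and both branches for if; $vs\Vdash e\wedge vs\Vdash e_1\wedge\mathrm{cFrame}(c_1,vs)$ for while. $\mathrm{biFrame}(B,vs)$: $\mathrm{cFrame}$ of both sides for embeds; $vs\Vdash\mathcal P$ for assert; $x\in vs\wedge vs\Vdash\mathcal P$ for havf; conjunction for sequence; $vs\Vdash e,e'$ and all four components for bi-if; $vs\Vdash e,e',\mathcal L,\mathcal R,E$ and body for bi-while. $\mathrm{modVars}(c)$ lists variables assigned or havoc'd in $c$; $\mathrm{modVarsR}(B)$ lists variables $x$ of $\mathsf{havf}\ x\ \mathcal P$ in $B$ and $\mathrm{modVars}(c')$ for each $\langle c|c'\rangle$ in $B$. $\mathrm{uchk}(c,vs)$: identity on skip, assignment, havoc, assert; homomorphic on sequence and if (same $vs$); $\mathsf{while}\ e\ \mathsf{vnt}\ e_1\ \mathsf{do}\ c_1\mapsto\mathsf{while}\ e\ \mathsf{vnt}\ e_1\ \mathsf{do}\ (x:=e_1;\mathrm{uchk}(c_1,vs);\mathsf{assert}\ \{s:0\le e_1(s)<s(x)\})$,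 $x$ an integer variable not in $vs$ nor $\mathrm{modVars}(\mathrm{uchk}(c_1,vs))$, chosen by a fixed choice function. $\mathrm{chk}(B,vs)$: $\langle c|c'\rangle\mapsto\langle c|\mathrm{uchk}(c',vs)\rangle$; $\mathsf{assert}\ \mathcal P$ unchanged; $\mathsf{havf}\ x\ \mathcal P\mapsto\mathsf{assert}(\exists|x.\mathcal P);\mathsf{havf}\ x\ \mathcal P$; homomorphic on sequence and bi-if (same $vs$); $\mathsf{while}\ e|e'\ \mathsf{algn}\ \mathcal P|\mathcal P'\ \mathsf{vnt}\ E\ \mathsf{do}\ B_1\mapsto\mathsf{while}\ e|e'\ \mathsf{algn}\ \mathcal P|\mathcal P'\ \mathsf{vnt}\ E\ \mathsf{do}\ B_2$, $B_2=\mathsf{havf}\ x_1\ \{(s,s'):s'(x_1)=E(s,s')\};\ \mathsf{havf}\ x_2\ \{(s,s'):s'(x_2)=\mathrm{tt}\iff(e'(s')=\mathrm{tt}\wedge(s,s')\in\mathcal P')\};\ \mathrm{chk}(B_1,vs);\ \mathsf{assert}\ \{(s,s'):s'(x_2)=\mathrm{tt}\Rightarrow0\le E(s,s')<s'(x_1)\}$, with $x_1$ (integer), $x_2$ (boolean) distinct, not in $vs$ nor $\mathrm{modVarsR}(\mathrm{chk}(B_1,vs))$, chosen by a fixed choice function. -}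

module Defs where

open import Data.Nat using (ℕ; suc; _⊔_) renaming (_≟_ to _≟ℕ_)
open import Data.Integer using (ℤ; _≤_; _<_; +_)
open import Data.Bool using (Bool; true; false)
open import Data.List using (List; []; _∷_; _++_; map; foldr)
open import Data.List.Membership.Propositional using (_∈_)
open import Data.Product using (_×_; _,_; Σ; ∃)
open import Data.Unit using (⊤)
open import Data.Empty using (⊥)
open import Relation.Nullary using (¬_; Dec; yes; no)
open import Relation.Binary.PropositionalEquality using (_≡_; refl)

data Ty : Set where
  int bool : Ty

Val : Ty → Set
Val int  = ℤ
Val bool = Bool

record Var : Set where
  constructor mkVar
  field
    name : ℕ
    ty   : Ty
open Var public

_≟Ty_ : (a b : Ty) → Dec (a ≡ b)
int  ≟Ty int  = yes refl
int  ≟Ty bool = no λ ()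
bool ≟Ty int  = no λ ()
bool ≟Ty bool = yes refl

_≟V_ : (x y : Var) → Dec (x ≡ y)
mkVar n a ≟V mkVar m b with n ≟ℕ m | a ≟Ty b
... | yes refl | yes refl = yes refl
... | no ne    | _        = no λ { refl → ne refl }
... | yes _    | no ne    = no λ { refl → ne refl }

Store : Set
Store = (x : Var) → Val (ty x)

_[_↦_] : Store → (x : Var) → Val (ty x) → Store
(s [ x ↦ v ]) y with x ≟V y
... | yes refl = v
... | no _     = s y

BExp : Set
BExp = Store → Bool

Assn : Set₁
Assn = Store → Set

Rel : Set₁
Rel = Store → Store → Set

Exp2 : Set
Exp2 = Store → Store → ℤ

_iff_ : Set → Set → Set
A iff B = (A → B) × (B → A)

∃∣ : Var → Rel → Rel
∃∣ x P s s' = Σ (Val (ty x)) λ v → P s (s' [ x ↦ v ])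

infixr 4 _⨾_
data Cmd : Set₁ where
  skip          : Cmd
  _:=_          : (x : Var) → (Store → Val (ty x)) → Cmd
  hav           : Var → Cmd
  assert        : Assn → Cmd
  _⨾_           : Cmd → Cmd → Cmd
  if_then_else_ : BExp → Cmd → Cmd → Cmd
  while_vnt_loop_ : BExp → (Store → ℤ) → Cmd → Cmd

data Res : Set where
  ok   : Store → Res
  fail : Res

data _/_⇓_ : Cmd → Store → Res → Set₁ where
  ⇓skip   : ∀ {s} → skip / s ⇓ ok s
  ⇓assign : ∀ {x e s} → (x := e) / s ⇓ ok (s [ x ↦ e s ])
  ⇓hav    : ∀ {x s} (v : Val (ty x)) → hav x / s ⇓ ok (s [ x ↦ v ])
  ⇓assert : ∀ {p s} → p s → assert p / s ⇓ ok s
  ⇓assertF : ∀ {p s} → ¬ p s → assert p / s ⇓ fail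
  ⇓seq    : ∀ {c₁ c₂ s t φ} → c₁ / s ⇓ ok t → c₂ / t ⇓ φ → (c₁ ⨾ c₂) / s ⇓ φ
  ⇓seqF   : ∀ {c₁ c₂ s} → c₁ / s ⇓ fail → (c₁ ⨾ c₂) / s ⇓ fail
  ⇓ifT    : ∀ {e c₁ c₂ s φ} → e s ≡ true → c₁ / s ⇓ φ → (if e then c₁ else c₂) / s ⇓ φ
  ⇓ifF    : ∀ {e c₁ c₂ s φ} → e s ≡ false → c₂ / s ⇓ φ → (if e then c₁ else c₂) / s ⇓ φ
  ⇓whileF : ∀ {e e₁ c s} → e s ≡ false → (while e vnt e₁ loop c) / s ⇓ ok s
  ⇓whileT : ∀ {e e₁ c s t φ} → e s ≡ true → c / s ⇓ ok t →
            (while e vnt e₁ loop c) / t ⇓ φ → (while e vnt e₁ loop c) / s ⇓ φ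
  ⇓whileX : ∀ {e e₁ c s} → e s ≡ true → c / s ⇓ fail →
            (while e vnt e₁ loop c) / s ⇓ fail

infixr 4 _⨟_
data Bicom : Set₁ where
  ⟨_∣_⟩  : Cmd → Cmd → Bicom
  bassert : Rel → Bicom
  havf    : Var → Rel → Bicom
  _⨟_     : Bicom → Bicom → Bicom
  bif     : BExp → BExp → Bicom → Bicom → Bicom → Bicom → Bicom
  -- bwhile e e' 𝓛 𝓡 E B  is  while e|e' algn 𝓛|𝓡 vnt E do B
  bwhile  : BExp → BExp → Rel → Rel → Exp2 → Bicom → Bicom

L : Bicom → Cmd
L ⟨ c ∣ c' ⟩ = c
L (bassert P) = skip
L (havf x P) = skip
L (B₁ ⨟ B₂) = L B₁ ⨾ L B₂
L (bif e e' B₁ B₂ B₃ B₄) = if e then L B₁ else L B₃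
L (bwhile e e' 𝓛 𝓡 E B) = while e vnt (λ _ → + 0) loop L B
-- (the variant of the projected loop is inert; we use the constant 0)

biL : Bicom → Bicom
biL B = ⟨ L B ∣ skip ⟩

ttE ffE : BExp
ttE _ = true
ffE _ = false

∅R : Rel
∅R _ _ = ⊥

biR : Bicom → Bicom
biR ⟨ c ∣ c' ⟩ = ⟨ skip ∣ c' ⟩
biR (bassert P) = bassert P
biR (havf x P) = havf x P
biR (B₁ ⨟ B₂) = biR B₁ ⨟ biR B₂
biR (bif e e' B₁ B₂ B₃ B₄) = bif ttE e' (biR B₁) (biR B₂) (biR B₃) (biR B₄)
biR (bwhile e e' 𝓛 𝓡 E B) = bwhile ffE e' ∅R 𝓡 E (biR B)

data BRes : Set where
  ok₂  : Store → Store → BRes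
  fail : BRes

data _/_∥_⇓_ : Bicom → Store → Store → BRes → Set₁ where
  ⇓embF₁ : ∀ {c c' s s'} → c / s ⇓ fail → ⟨ c ∣ c' ⟩ / s ∥ s' ⇓ fail
  ⇓embF₂ : ∀ {c c' s s' t} → c / s ⇓ ok t → c' / s' ⇓ fail → ⟨ c ∣ c' ⟩ / s ∥ s' ⇓ fail
  ⇓emb   : ∀ {c c' s s' t t'} → c / s ⇓ ok t → c' / s' ⇓ ok t' → ⟨ c ∣ c' ⟩ / s ∥ s' ⇓ ok₂ t t'
  ⇓bassert  : ∀ {P s s'} → P s s' → bassert P / s ∥ s' ⇓ ok₂ s s'
  ⇓bassertF : ∀ {P s s'} → ¬ P s s' → bassert P / s ∥ s' ⇓ fail
  ⇓havf  : ∀ {x P s s'} (n : Val (ty x)) → P s (s' [ x ↦ n ]) →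
           havf x P / s ∥ s' ⇓ ok₂ s (s' [ x ↦ n ])
  ⇓bseq  : ∀ {B₁ B₂ s s' u u' φ} → B₁ / s ∥ s' ⇓ ok₂ u u' → B₂ / u ∥ u' ⇓ φ →
           (B₁ ⨟ B₂) / s ∥ s' ⇓ φ
  ⇓bseqF : ∀ {B₁ B₂ s s'} → B₁ / s ∥ s' ⇓ fail → (B₁ ⨟ B₂) / s ∥ s' ⇓ fail
  ⇓bifTT : ∀ {e e' B₁ B₂ B₃ B₄ s s' φ} → e s ≡ true → e' s' ≡ true →
           B₁ / s ∥ s' ⇓ φ → bif e e' B₁ B₂ B₃ B₄ / s ∥ s' ⇓ φ
  ⇓bifTF : ∀ {e e' B₁ B₂ B₃ B₄ s s' φ} → e s ≡ true → e' s' ≡ false →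
           B₂ / s ∥ s' ⇓ φ → bif e e' B₁ B₂ B₃ B₄ / s ∥ s' ⇓ φ
  ⇓bifFT : ∀ {e e' B₁ B₂ B₃ B₄ s s' φ} → e s ≡ false → e' s' ≡ true →
           B₃ / s ∥ s' ⇓ φ → bif e e' B₁ B₂ B₃ B₄ / s ∥ s' ⇓ φ
  ⇓bifFF : ∀ {e e' B₁ B₂ B₃ B₄ s s' φ} → e s ≡ false → e' s' ≡ false →
           B₄ / s ∥ s' ⇓ φ → bif e e' B₁ B₂ B₃ B₄ / s ∥ s' ⇓ φ
  ⇓bwStop : ∀ {e e' 𝓛 𝓡 E B s s'} → e s ≡ false → e' s' ≡ false →
            bwhile e e' 𝓛 𝓡 E B / s ∥ s' ⇓ ok₂ s s'
  ⇓bwL  : ∀ {e e' 𝓛 𝓡 E B s s' u u' φ} → e s ≡ true → 𝓛 s s' →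
          biL B / s ∥ s' ⇓ ok₂ u u' → bwhile e e' 𝓛 𝓡 E B / u ∥ u' ⇓ φ →
          bwhile e e' 𝓛 𝓡 E B / s ∥ s' ⇓ φ
  ⇓bwLF : ∀ {e e' 𝓛 𝓡 E B s s'} → e s ≡ true → 𝓛 s s' →
          biL B / s ∥ s' ⇓ fail → bwhile e e' 𝓛 𝓡 E B / s ∥ s' ⇓ fail
  ⇓bwR  : ∀ {e e' 𝓛 𝓡 E B s s' u u' φ} → ¬ (e s ≡ true × 𝓛 s s') →
          e' s' ≡ true → 𝓡 s s' →
          biR B / s ∥ s' ⇓ ok₂ u u' → bwhile e e' 𝓛 𝓡 E B / u ∥ u' ⇓ φ →
          bwhile e e' 𝓛 𝓡 E B / s ∥ s' ⇓ φ
  ⇓bwRF : ∀ {e e' 𝓛 𝓡 E B s s'} → ¬ (e s ≡ true × 𝓛 s s') →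
          e' s' ≡ true → 𝓡 s s' →
          biR B / s ∥ s' ⇓ fail → bwhile e e' 𝓛 𝓡 E B / s ∥ s' ⇓ fail
  ⇓bwB  : ∀ {e e' 𝓛 𝓡 E B s s' u u' φ} → e s ≡ true → e' s' ≡ true →
          ¬ 𝓛 s s' → ¬ 𝓡 s s' →
          B / s ∥ s' ⇓ ok₂ u u' → bwhile e e' 𝓛 𝓡 E B / u ∥ u' ⇓ φ →
          bwhile e e' 𝓛 𝓡 E B / s ∥ s' ⇓ φ
  ⇓bwBF : ∀ {e e' 𝓛 𝓡 E B s s'} → e s ≡ true → e' s' ≡ true →
          ¬ 𝓛 s s' → ¬ 𝓡 s s' →
          B / s ∥ s' ⇓ fail → bwhile e e' 𝓛 𝓡 E B / s ∥ s' ⇓ fail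
  ⇓bwXL : ∀ {e e' 𝓛 𝓡 E B s s'} → e s ≡ true → e' s' ≡ false → ¬ 𝓛 s s' →
          bwhile e e' 𝓛 𝓡 E B / s ∥ s' ⇓ fail
  ⇓bwXR : ∀ {e e' 𝓛 𝓡 E B s s'} → e s ≡ false → e' s' ≡ true → ¬ 𝓡 s s' →
          bwhile e e' 𝓛 𝓡 E B / s ∥ s' ⇓ fail

_=[_]_ : Store → List Var → Store → Set
s =[ vs ] t = ∀ x → x ∈ vs → s x ≡ t x

_⊩e_ : {A : Set} → List Var → (Store → A) → Set
vs ⊩e e = ∀ s t → s =[ vs ] t → e s ≡ e t

_⊩p_ : List Var → Assn → Set
vs ⊩p p = ∀ s t → s =[ vs ] t → p s iff p t

_⊩E_ : List Var → Exp2 → Set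
vs ⊩E E = ∀ s s' t t' → s =[ vs ] t → s' =[ vs ] t' → E s s' ≡ E t t'

_⊩R_ : List Var → Rel → Set
vs ⊩R 𝓡 = ∀ s s' t t' → s =[ vs ] t → s' =[ vs ] t' → 𝓡 s s' iff 𝓡 t t'

_⊩c_ : List Var → Cmd → Set₁
vs ⊩c c =
  (∀ s s' t → s =[ vs ] s' → c / s ⇓ ok t →
     ∃ λ t' → c / s' ⇓ ok t' × t =[ vs ] t')
  × (∀ s s' → s =[ vs ] s' → c / s ⇓ fail → c / s' ⇓ fail)

_⊩B_ : List Var → Bicom → Set₁
vs ⊩B B =
  (∀ s s' t t' u u' → s =[ vs ] t → s' =[ vs ] t' → B / s ∥ s' ⇓ ok₂ u u' →
     ∃ λ v → ∃ λ v' → B / t ∥ t' ⇓ ok₂ v v' × u =[ vs ] v × u' =[ vs ] v')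
  × (∀ s s' t t' → s =[ vs ] t → s' =[ vs ] t' → B / s ∥ s' ⇓ fail →
       B / t ∥ t' ⇓ fail)

cFrame : Cmd → List Var → Set
cFrame skip vs = ⊤
cFrame (x := e) vs = x ∈ vs × vs ⊩e e
cFrame (hav x) vs = x ∈ vs
cFrame (assert p) vs = vs ⊩p p
cFrame (c₁ ⨾ c₂) vs = cFrame c₁ vs × cFrame c₂ vs
cFrame (if e then c₁ else c₂) vs = vs ⊩e e × cFrame c₁ vs × cFrame c₂ vs
cFrame (while e vnt e₁ loop c₁) vs = vs ⊩e e × vs ⊩e e₁ × cFrame c₁ vs

biFrame : Bicom → List Var → Set
biFrame ⟨ c ∣ c' ⟩ vs = cFrame c vs × cFrame c' vs
biFrame (bassert P) vs = vs ⊩R P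
biFrame (havf x P) vs = x ∈ vs × vs ⊩R P
biFrame (B₁ ⨟ B₂) vs = biFrame B₁ vs × biFrame B₂ vs
biFrame (bif e e' B₁ B₂ B₃ B₄) vs =
  vs ⊩e e × vs ⊩e e' × biFrame B₁ vs × biFrame B₂ vs × biFrame B₃ vs × biFrame B₄ vs
biFrame (bwhile e e' 𝓛 𝓡 E B) vs =
  vs ⊩e e × vs ⊩e e' × vs ⊩R 𝓛 × vs ⊩R 𝓡 × vs ⊩E E × biFrame B vs

modVars : Cmd → List Var
modVars skip = []
modVars (x := e) = x ∷ []
modVars (hav x) = x ∷ []
modVars (assert p) = []
modVars (c₁ ⨾ c₂) = modVars c₁ ++ modVars c₂
modVars (if e then c₁ else c₂) = modVars c₁ ++ modVars c₂
modVars (while e vnt e₁ loop c) = modVars c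

modVarsR : Bicom → List Var
modVarsR ⟨ c ∣ c' ⟩ = modVars c'
modVarsR (bassert P) = []
modVarsR (havf x P) = x ∷ []
modVarsR (B₁ ⨟ B₂) = modVarsR B₁ ++ modVarsR B₂
modVarsR (bif e e' B₁ B₂ B₃ B₄) =
  modVarsR B₁ ++ modVarsR B₂ ++ modVarsR B₃ ++ modVarsR B₄
modVarsR (bwhile e e' 𝓛 𝓡 E B) = modVarsR B

freshName : List Var → ℕ
freshName xs = suc (foldr _⊔_ 0 (map name xs))

uchk : Cmd → List Var → Cmd
uchk skip vs = skip
uchk (x := e) vs = x := e
uchk (hav x) vs = hav x
uchk (assert p) vs = assert p
uchk (c₁ ⨾ c₂) vs = uchk c₁ vs ⨾ uchk c₂ vs
uchk (if e then c₁ else c₂) vs = if e then uchk c₁ vs else uchk c₂ vs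
uchk (while e vnt e₁ loop c₁) vs =
  while e vnt e₁ loop ((x := e₁) ⨾ uchk c₁ vs ⨾ assert (λ s → (+ 0 ≤ e₁ s) × (e₁ s < s x)))
  where
    x : Var
    x = mkVar (freshName (vs ++ modVars (uchk c₁ vs))) int

chk : Bicom → List Var → Bicom
chk ⟨ c ∣ c' ⟩ vs = ⟨ c ∣ uchk c' vs ⟩
chk (bassert P) vs = bassert P
chk (havf x P) vs = bassert (∃∣ x P) ⨟ havf x P
chk (B₁ ⨟ B₂) vs = chk B₁ vs ⨟ chk B₂ vs
chk (bif e e' B₁ B₂ B₃ B₄) vs = bif e e' (chk B₁ vs) (chk B₂ vs) (chk B₃ vs) (chk B₄ vs)
chk (bwhile e e' 𝓟 𝓟' E B₁) vs = bwhile e e' 𝓟 𝓟' E B₂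
  where
    n : ℕ
    n = freshName (vs ++ modVarsR (chk B₁ vs))
    x₁ x₂ : Var
    x₁ = mkVar n int
    x₂ = mkVar n bool
    B₂ : Bicom
    B₂ = havf x₁ (λ s s' → s' x₁ ≡ E s s')
       ⨟ havf x₂ (λ s s' → (s' x₂ ≡ true) iff (e' s' ≡ true × 𝓟' s s'))
       ⨟ chk B₁ vs
       ⨟ bassert (λ s s' → s' x₂ ≡ true → (+ 0 ≤ E s s') × (E s s' < s' x₁))

-- Every construct of the two languages transports agreement on vs, so the
-- framing judgements follow by structural induction; the only difficulty is the
-- instrumentation added by uchk and chk, which writes and reads fresh variables
-- outside vs.  We therefore generalise the judgements to different variable
-- lists before and after a run (and separate lists for the two stores of a
-- bicommand).  A fresh variable joins the list at the assignment or havoc that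
-- initialises it identically in both runs, stays there because the instrumented
-- code never modifies it, so the variant check compares equal values, and is
-- dropped at the end of the loop body.
module Submission where

open import Data.Bool using (Bool; true)
open import Data.Integer using (ℤ; +_) renaming (_≤_ to _≤ℤ_; _<_ to _<ℤ_)
open import Data.List using (List; _∷_; _++_; map; foldr)
open import Data.List.Membership.Propositional using (_∈_; _∉_)
open import Data.List.Membership.Propositional.Properties using (∈-++⁺ˡ; ∈-++⁺ʳ)
open import Data.List.Relation.Binary.Subset.Propositional using (_⊆_)
open import Data.List.Relation.Unary.Any using (here; there)
open import Data.Nat using (ℕ; _⊔_) renaming (_≤_ to _≤ℕ_)
open import Data.Nat.Properties using (m≤m⊔n; m≤n⊔m; ≤-trans; n≮n)
open import Data.Product using (_×_; _,_; ∃; proj₁; proj₂; map₁; map₂)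
open import Function using (_∘_)
open import Relation.Nullary using (¬_; yes; no; contradiction)
open import Relation.Binary.PropositionalEquality
  using (_≡_; _≢_; refl; sym; trans; cong; cong₂; subst)

open import Defs

iff-cong : ∀ {A A' B B' : Set} → A iff A' → B iff B' → (A iff B) iff (A' iff B')
iff-cong (f , f⁻) (g , g⁻) =
  (λ (h , h⁻) → g ∘ h ∘ f⁻ , f ∘ h⁻ ∘ g⁻) , (λ (h , h⁻) → g⁻ ∘ h ∘ f , f⁻ ∘ h⁻ ∘ g)

×-iff : ∀ {A A' B B' : Set} → A iff A' → B iff B' → (A × B) iff (A' × B')
×-iff (f , f⁻) (g , g⁻) = (λ (a , b) → f a , g b) , (λ (a , b) → f⁻ a , g⁻ b)

≡-iff : ∀ {A : Set} {a a' b : A} → a ≡ a' → (a ≡ b) iff (a' ≡ b)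
≡-iff a≡a' = trans (sym a≡a') , trans a≡a'

=[]-sym : ∀ {vs s t} → s =[ vs ] t → t =[ vs ] s
=[]-sym a x x∈vs = sym (a x x∈vs)

=[]-⊆ : ∀ {vs ws s t} → ws ⊆ vs → s =[ vs ] t → s =[ ws ] t
=[]-⊆ ws⊆vs a x x∈ws = a x (ws⊆vs x∈ws)

=[]-∷⁻ : ∀ {x vs s t} → s =[ x ∷ vs ] t → s =[ vs ] t
=[]-∷⁻ = =[]-⊆ there

=[]-∷⁺ : ∀ {x vs s t} → s x ≡ t x → s =[ vs ] t → s =[ x ∷ vs ] t
=[]-∷⁺ sx≡tx a _ (here refl) = sx≡tx
=[]-∷⁺ sx≡tx a y (there y∈vs) = a y y∈vs

lookup-update-≢ : ∀ (s : Store) {x y} (v : Val (ty x)) → x ≢ y → (s [ x ↦ v ]) y ≡ s y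
lookup-update-≢ s {x} {y} v x≢y with x ≟V y
... | yes x≡y = contradiction x≡y x≢y
... | no _    = refl

update-=[] : ∀ {vs} (s t : Store) x {v v' : Val (ty x)} → v ≡ v' →
             s =[ vs ] t → (s [ x ↦ v ]) =[ x ∷ vs ] (t [ x ↦ v' ])
update-=[] s t x refl a y y∈x∷vs with x ≟V y | y∈x∷vs
... | yes refl | _          = refl
... | no x≢y   | here y≡x   = contradiction (sym y≡x) x≢y
... | no _     | there y∈vs = a y y∈vs

name≤max : ∀ {y} xs → y ∈ xs → name y ≤ℕ foldr _⊔_ 0 (map name xs)
name≤max (x ∷ xs) (here refl) = m≤m⊔n (name x) _
name≤max (x ∷ xs) (there y∈xs) = ≤-trans (name≤max xs y∈xs) (m≤n⊔m (name x) _)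

freshName-∉ : ∀ xs τ → mkVar (freshName xs) τ ∉ xs
freshName-∉ xs τ x∈xs = n≮n _ (name≤max xs x∈xs)

freshName-∉ʳ : ∀ vs ys τ → mkVar (freshName (vs ++ ys)) τ ∉ ys
freshName-∉ʳ vs ys τ x∈ys = freshName-∉ (vs ++ ys) τ (∈-++⁺ʳ vs x∈ys)

⇓-unmodified : ∀ {c s t z} → c / s ⇓ ok t → z ∉ modVars c → t z ≡ s z
⇓-unmodified ⇓skip z∉ = refl
⇓-unmodified (⇓assign {x = x} {s = s}) z∉ = lookup-update-≢ s {x} _ λ { refl → z∉ (here refl) }
⇓-unmodified (⇓hav {x = x} {s = s} v) z∉ = lookup-update-≢ s {x} v λ { refl → z∉ (here refl) }
⇓-unmodified (⇓assert _) z∉ = refl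
⇓-unmodified {c₁ ⨾ c₂} (⇓seq d₁ d₂) z∉ =
  trans (⇓-unmodified d₂ (z∉ ∘ ∈-++⁺ʳ (modVars c₁))) (⇓-unmodified d₁ (z∉ ∘ ∈-++⁺ˡ))
⇓-unmodified (⇓ifT _ d) z∉ = ⇓-unmodified d (z∉ ∘ ∈-++⁺ˡ)
⇓-unmodified {if _ then c₁ else _} (⇓ifF _ d) z∉ = ⇓-unmodified d (z∉ ∘ ∈-++⁺ʳ (modVars c₁))
⇓-unmodified (⇓whileF _) z∉ = refl
⇓-unmodified (⇓whileT _ d dw) z∉ = trans (⇓-unmodified dw z∉) (⇓-unmodified d z∉)

modVarsR-biR : ∀ B → modVarsR (biR B) ≡ modVarsR B
modVarsR-biR ⟨ c ∣ c' ⟩ = refl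
modVarsR-biR (bassert P) = refl
modVarsR-biR (havf x P) = refl
modVarsR-biR (B₁ ⨟ B₂) = cong₂ _++_ (modVarsR-biR B₁) (modVarsR-biR B₂)
modVarsR-biR (bif e e' B₁ B₂ B₃ B₄) =
  cong₂ _++_ (modVarsR-biR B₁)
    (cong₂ _++_ (modVarsR-biR B₂) (cong₂ _++_ (modVarsR-biR B₃) (modVarsR-biR B₄)))
modVarsR-biR (bwhile e e' 𝓛 𝓡 E B) = modVarsR-biR B

biR-idem : ∀ B → biR (biR B) ≡ biR B
biR-idem ⟨ c ∣ c' ⟩ = refl
biR-idem (bassert P) = refl
biR-idem (havf x P) = refl
biR-idem (B₁ ⨟ B₂) = cong₂ _⨟_ (biR-idem B₁) (biR-idem B₂)
biR-idem (bif e e' B₁ B₂ B₃ B₄)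
  rewrite biR-idem B₁ | biR-idem B₂ | biR-idem B₃ | biR-idem B₄ = refl
biR-idem (bwhile e e' 𝓛 𝓡 E B) = cong (bwhile ffE e' ∅R 𝓡 E) (biR-idem B)

freshName-∉-biR : ∀ vs X τ → mkVar (freshName (vs ++ modVarsR X)) τ ∉ modVarsR (biR X)
freshName-∉-biR vs X τ =
  freshName-∉ʳ vs (modVarsR X) τ ∘ subst (mkVar (freshName (vs ++ modVarsR X)) τ ∈_) (modVarsR-biR X)

⇓₂-unmodifiedʳ : ∀ {B s s' u u' z} → B / s ∥ s' ⇓ ok₂ u u' → z ∉ modVarsR B → u' z ≡ s' z
⇓₂-unmodifiedʳ (⇓emb _ d') z∉ = ⇓-unmodified d' z∉
⇓₂-unmodifiedʳ (⇓bassert _) z∉ = refl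
⇓₂-unmodifiedʳ (⇓havf {x = x} {s' = s'} n _) z∉ = lookup-update-≢ s' {x} n λ { refl → z∉ (here refl) }
⇓₂-unmodifiedʳ {B₁ ⨟ B₂} (⇓bseq d₁ d₂) z∉ =
  trans (⇓₂-unmodifiedʳ d₂ (z∉ ∘ ∈-++⁺ʳ (modVarsR B₁))) (⇓₂-unmodifiedʳ d₁ (z∉ ∘ ∈-++⁺ˡ))
⇓₂-unmodifiedʳ (⇓bifTT _ _ d) z∉ = ⇓₂-unmodifiedʳ d (z∉ ∘ ∈-++⁺ˡ)
⇓₂-unmodifiedʳ {bif _ _ B₁ _ _ _} (⇓bifTF _ _ d) z∉ =
  ⇓₂-unmodifiedʳ d (z∉ ∘ ∈-++⁺ʳ (modVarsR B₁) ∘ ∈-++⁺ˡ)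
⇓₂-unmodifiedʳ {bif _ _ B₁ B₂ _ _} (⇓bifFT _ _ d) z∉ =
  ⇓₂-unmodifiedʳ d (z∉ ∘ ∈-++⁺ʳ (modVarsR B₁) ∘ ∈-++⁺ʳ (modVarsR B₂) ∘ ∈-++⁺ˡ)
⇓₂-unmodifiedʳ {bif _ _ B₁ B₂ B₃ _} (⇓bifFF _ _ d) z∉ =
  ⇓₂-unmodifiedʳ d (z∉ ∘ ∈-++⁺ʳ (modVarsR B₁) ∘ ∈-++⁺ʳ (modVarsR B₂) ∘ ∈-++⁺ʳ (modVarsR B₃))
⇓₂-unmodifiedʳ (⇓bwStop _ _) z∉ = refl
⇓₂-unmodifiedʳ (⇓bwL _ _ (⇓emb _ ⇓skip) dw) z∉ = ⇓₂-unmodifiedʳ dw z∉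
⇓₂-unmodifiedʳ {bwhile _ _ _ _ _ B} {z = z} (⇓bwR _ _ _ d dw) z∉ =
  trans (⇓₂-unmodifiedʳ dw z∉) (⇓₂-unmodifiedʳ d (z∉ ∘ subst (z ∈_) (modVarsR-biR B)))
⇓₂-unmodifiedʳ (⇓bwB _ _ _ _ d dw) z∉ = trans (⇓₂-unmodifiedʳ dw z∉) (⇓₂-unmodifiedʳ d z∉)

_⊩c_⇒_ : List Var → Cmd → List Var → Set₁
vs ⊩c c ⇒ ws =
  (∀ s s' t → s =[ vs ] s' → c / s ⇓ ok t → ∃ λ t' → c / s' ⇓ ok t' × t =[ ws ] t')
  × (∀ s s' → s =[ vs ] s' → c / s ⇓ fail → c / s' ⇓ fail)

⊩e-transfer : ∀ {A : Set} {vs} {e : Store → A} {s t b} → vs ⊩e e → s =[ vs ] t → e s ≡ b → e t ≡ b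
⊩e-transfer fe a es≡b = trans (sym (fe _ _ a)) es≡b

⊩p-∘ : ∀ {A : Set} {vs} {f : Store → A} (Q : A → Set) → vs ⊩e f → vs ⊩p (Q ∘ f)
⊩p-∘ Q ff s t a = subst Q (ff s t a) , subst Q (sym (ff s t a))

⊩c-weaken : ∀ {vs ws us c} → us ⊆ ws → vs ⊩c c ⇒ ws → vs ⊩c c ⇒ us
⊩c-weaken us⊆ws (run , fails) =
  (λ s s' t a → map₂ (map₂ (=[]-⊆ us⊆ws)) ∘ run s s' t a) , fails

⊩c-extend : ∀ {vs ws x c} → vs ⊩c c ⇒ ws → x ∉ modVars c → (x ∷ vs) ⊩c c ⇒ (x ∷ ws)
⊩c-extend {x = x} (run , fails) x∉ = run′ , λ s s' → fails s s' ∘ =[]-∷⁻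
  where
  run′ : ∀ s s' t → s =[ x ∷ _ ] s' → _ / s ⇓ ok t → ∃ λ t' → _ / s' ⇓ ok t' × t =[ x ∷ _ ] t'
  run′ s s' t a d with run s s' t (=[]-∷⁻ a) d
  ... | t' , d' , b =
    t' , d' , =[]-∷⁺ (trans (⇓-unmodified d x∉) (trans (a x (here refl)) (sym (⇓-unmodified d' x∉)))) b

skip-⊩c : ∀ {vs} → vs ⊩c skip
skip-⊩c = (λ { s s' _ a ⇓skip → s' , ⇓skip , a }) , λ { _ _ _ () }

:=-⊩c : ∀ {vs x e} → vs ⊩e e → vs ⊩c (x := e) ⇒ (x ∷ vs)
:=-⊩c {x = x} {e} fe =
  (λ { s s' _ a ⇓assign → s' [ x ↦ e s' ] , ⇓assign , update-=[] s s' x (fe s s' a) a })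
  , λ { _ _ _ () }

hav-⊩c : ∀ {vs x} → vs ⊩c hav x ⇒ (x ∷ vs)
hav-⊩c {x = x} = (λ { s s' _ a (⇓hav v) → s' [ x ↦ v ] , ⇓hav v , update-=[] s s' x refl a })
  , λ { _ _ _ () }

assert-⊩c : ∀ {vs p} → vs ⊩p p → vs ⊩c assert p
assert-⊩c fp =
  (λ { s s' _ a (⇓assert ps) → s' , ⇓assert (proj₁ (fp s s' a) ps) , a })
  , λ { s s' a (⇓assertF ¬ps) → ⇓assertF (¬ps ∘ proj₂ (fp s s' a)) }

⨾-⊩c : ∀ {vs ws us c₁ c₂} → vs ⊩c c₁ ⇒ ws → ws ⊩c c₂ ⇒ us → vs ⊩c (c₁ ⨾ c₂) ⇒ us
⨾-⊩c {vs} {ws} {us} {c₁} {c₂} (run₁ , fails₁) (run₂ , fails₂) = run , fails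
  where
  run : ∀ s s' t → s =[ vs ] s' → (c₁ ⨾ c₂) / s ⇓ ok t → ∃ λ t' → (c₁ ⨾ c₂) / s' ⇓ ok t' × t =[ us ] t'
  run s s' t a (⇓seq d₁ d₂) with run₁ _ s' _ a d₁
  ... | u' , d₁' , b with run₂ _ u' _ b d₂
  ... | t' , d₂' , b' = t' , ⇓seq d₁' d₂' , b'
  fails : ∀ s s' → s =[ vs ] s' → (c₁ ⨾ c₂) / s ⇓ fail → (c₁ ⨾ c₂) / s' ⇓ fail
  fails s s' a (⇓seq d₁ d₂) with run₁ _ s' _ a d₁
  ... | u' , d₁' , b = ⇓seq d₁' (fails₂ _ u' b d₂)
  fails s s' a (⇓seqF d₁) = ⇓seqF (fails₁ s s' a d₁)

if-⊩c : ∀ {vs ws e c₁ c₂} → vs ⊩e e → vs ⊩c c₁ ⇒ ws → vs ⊩c c₂ ⇒ ws →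
        vs ⊩c (if e then c₁ else c₂) ⇒ ws
if-⊩c fe (run₁ , fails₁) (run₂ , fails₂) = run , fails
  where
  run : ∀ s s' t → _ → _ / s ⇓ ok t → ∃ λ t' → _ / s' ⇓ ok t' × t =[ _ ] t'
  run s s' t a (⇓ifT es d) = map₂ (map₁ (⇓ifT (⊩e-transfer fe a es))) (run₁ s s' t a d)
  run s s' t a (⇓ifF es d) = map₂ (map₁ (⇓ifF (⊩e-transfer fe a es))) (run₂ s s' t a d)
  fails : ∀ s s' → _ → _ / s ⇓ fail → _ / s' ⇓ fail
  fails s s' a (⇓ifT es d) = ⇓ifT (⊩e-transfer fe a es) (fails₁ s s' a d)
  fails s s' a (⇓ifF es d) = ⇓ifF (⊩e-transfer fe a es) (fails₂ s s' a d)

while-⊩c : ∀ {vs e e₁ c} → vs ⊩e e → vs ⊩c c → vs ⊩c (while e vnt e₁ loop c)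
while-⊩c {vs} {e} {e₁} {c} fe (runᵇ , failsᵇ) = run , fails
  where
  W : Cmd
  W = while e vnt e₁ loop c
  run : ∀ s s' t → s =[ vs ] s' → W / s ⇓ ok t → ∃ λ t' → W / s' ⇓ ok t' × t =[ vs ] t'
  run s s' _ a (⇓whileF es) = s' , ⇓whileF (⊩e-transfer fe a es) , a
  run s s' t a (⇓whileT es d dw) with runᵇ _ s' _ a d
  ... | u' , d' , b = map₂ (map₁ (⇓whileT (⊩e-transfer fe a es) d')) (run _ u' t b dw)
  fails : ∀ s s' → s =[ vs ] s' → W / s ⇓ fail → W / s' ⇓ fail
  fails s s' a (⇓whileT es d dw) with runᵇ _ s' _ a d
  ... | u' , d' , b = ⇓whileT (⊩e-transfer fe a es) d' (fails _ u' b dw)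
  fails s s' a (⇓whileX es d) = ⇓whileX (⊩e-transfer fe a es) (failsᵇ s s' a d)

cFrame⇒⊩c : ∀ {vs} c → cFrame c vs → vs ⊩c c
cFrame⇒⊩c skip _ = skip-⊩c
cFrame⇒⊩c (x := e) (_ , fe) = ⊩c-weaken there (:=-⊩c fe)
cFrame⇒⊩c (hav x) _ = ⊩c-weaken there hav-⊩c
cFrame⇒⊩c (assert p) fp = assert-⊩c fp
cFrame⇒⊩c (c₁ ⨾ c₂) (f₁ , f₂) = ⨾-⊩c (cFrame⇒⊩c c₁ f₁) (cFrame⇒⊩c c₂ f₂)
cFrame⇒⊩c (if e then c₁ else c₂) (fe , f₁ , f₂) = if-⊩c fe (cFrame⇒⊩c c₁ f₁) (cFrame⇒⊩c c₂ f₂)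
cFrame⇒⊩c (while e vnt e₁ loop c) (fe , _ , f) = while-⊩c fe (cFrame⇒⊩c c f)

variantCheck-⊩c : ∀ {vs n c} {e₁ : Store → ℤ} → vs ⊩e e₁ → vs ⊩c c → mkVar n int ∉ modVars c →
  vs ⊩c ((mkVar n int := e₁) ⨾ c ⨾ assert (λ s → (+ 0 ≤ℤ e₁ s) × (e₁ s <ℤ s (mkVar n int))))
variantCheck-⊩c {n = n} {e₁ = e₁} fe₁ fc x∉ =
  ⊩c-weaken there (⨾-⊩c (:=-⊩c fe₁) (⨾-⊩c (⊩c-extend fc x∉) (assert-⊩c (⊩p-∘ bounded fe₁x))))
  where
  bounded : ℤ × ℤ → Set
  bounded (m , k) = (+ 0 ≤ℤ m) × (m <ℤ k)
  fe₁x : _ ⊩e (λ s → e₁ s , s (mkVar n int))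
  fe₁x s t a = cong₂ _,_ (fe₁ s t (=[]-∷⁻ a)) (a _ (here refl))

uchk-⊩c : ∀ vs c → cFrame c vs → vs ⊩c uchk c vs
uchk-⊩c vs skip _ = skip-⊩c
uchk-⊩c vs (x := e) (_ , fe) = ⊩c-weaken there (:=-⊩c fe)
uchk-⊩c vs (hav x) _ = ⊩c-weaken there hav-⊩c
uchk-⊩c vs (assert p) fp = assert-⊩c fp
uchk-⊩c vs (c₁ ⨾ c₂) (f₁ , f₂) = ⨾-⊩c (uchk-⊩c vs c₁ f₁) (uchk-⊩c vs c₂ f₂)
uchk-⊩c vs (if e then c₁ else c₂) (fe , f₁ , f₂) = if-⊩c fe (uchk-⊩c vs c₁ f₁) (uchk-⊩c vs c₂ f₂)
uchk-⊩c vs (while e vnt e₁ loop c) (fe , fe₁ , f) =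
  while-⊩c fe (variantCheck-⊩c fe₁ (uchk-⊩c vs c f) (freshName-∉ʳ vs (modVars (uchk c vs)) int))

_⊩R²_ : List Var × List Var → Rel → Set
(vs , vs') ⊩R² P = ∀ s s' t t' → s =[ vs ] t → s' =[ vs' ] t' → P s s' iff P t t'

_⊩B_⇒_ : List Var × List Var → Bicom → List Var × List Var → Set₁
(vs , vs') ⊩B B ⇒ (ws , ws') =
  (∀ s s' t t' u u' → s =[ vs ] t → s' =[ vs' ] t' → B / s ∥ s' ⇓ ok₂ u u' →
     ∃ λ v → ∃ λ v' → B / t ∥ t' ⇓ ok₂ v v' × u =[ ws ] v × u' =[ ws' ] v')
  × (∀ s s' t t' → s =[ vs ] t → s' =[ vs' ] t' → B / s ∥ s' ⇓ fail → B / t ∥ t' ⇓ fail)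

⊩R²-∘ : ∀ {A : Set} {vs vs'} {f : Store → Store → A} (Q : A → Set) →
        (∀ s s' t t' → s =[ vs ] t → s' =[ vs' ] t' → f s s' ≡ f t t') →
        (vs , vs') ⊩R² (λ s s' → Q (f s s'))
⊩R²-∘ Q ff s s' t t' a a' = subst Q (ff s s' t t' a a') , subst Q (sym (ff s s' t t' a a'))

⊩R²-⊆ʳ : ∀ {vs vs' ws' P} → vs' ⊆ ws' → (vs , vs') ⊩R² P → (vs , ws') ⊩R² P
⊩R²-⊆ʳ vs'⊆ws' fP s s' t t' a a' = fP s s' t t' a (=[]-⊆ vs'⊆ws' a')

∃∣-⊩R² : ∀ {vs vs' x P} → (vs , x ∷ vs') ⊩R² P → (vs , vs') ⊩R² ∃∣ x P
∃∣-⊩R² {x = x} fP s s' t t' a a' =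
  (λ { (v , p) → v , proj₁ (fP s _ t _ a (update-=[] s' t' x refl a')) p })
  , (λ { (v , p) → v , proj₂ (fP s _ t _ a (update-=[] s' t' x refl a')) p })

∅R-⊩R : ∀ {vs} → vs ⊩R ∅R
∅R-⊩R _ _ _ _ _ _ = (λ ()) , (λ ())

const-⊩e : ∀ {A : Set} {vs} {b : A} → vs ⊩e (λ _ → b)
const-⊩e _ _ _ = refl

⊩B-weakenʳ : ∀ {vs vs' ws ws' us' B} → us' ⊆ ws' →
             (vs , vs') ⊩B B ⇒ (ws , ws') → (vs , vs') ⊩B B ⇒ (ws , us')
⊩B-weakenʳ us'⊆ws' (run , fails) =
  (λ s s' t t' u u' a a' → map₂ (map₂ (map₂ (map₂ (=[]-⊆ us'⊆ws')))) ∘ run s s' t t' u u' a a')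
  , fails

⊩B-extendʳ : ∀ {vs vs' ws ws' x B} → (vs , vs') ⊩B B ⇒ (ws , ws') → x ∉ modVarsR B →
             (vs , x ∷ vs') ⊩B B ⇒ (ws , x ∷ ws')
⊩B-extendʳ {x = x} (run , fails) x∉ = run′ , λ s s' t t' a → fails s s' t t' a ∘ =[]-∷⁻
  where
  run′ : ∀ s s' t t' u u' → s =[ _ ] t → s' =[ x ∷ _ ] t' → _ / s ∥ s' ⇓ ok₂ u u' →
     ∃ λ v → ∃ λ v' → _ / t ∥ t' ⇓ ok₂ v v' × u =[ _ ] v × u' =[ x ∷ _ ] v'
  run′ s s' t t' u u' a a' d with run s s' t t' u u' a (=[]-∷⁻ a') d
  ... | v , v' , d' , b , b' =
    v , v' , d' , b ,
    =[]-∷⁺ (trans (⇓₂-unmodifiedʳ d x∉) (trans (a' x (here refl)) (sym (⇓₂-unmodifiedʳ d' x∉)))) b'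

emb-⊩B : ∀ {vs vs' ws ws' c c'} → vs ⊩c c ⇒ ws → vs' ⊩c c' ⇒ ws' →
         (vs , vs') ⊩B ⟨ c ∣ c' ⟩ ⇒ (ws , ws')
emb-⊩B (run , fails) (run' , fails') =
  (λ { s s' t t' _ _ a a' (⇓emb d d') → let v , e , b = run s t _ a d ; v' , e' , b' = run' s' t' _ a' d'
                                        in v , v' , ⇓emb e e' , b , b' })
  , λ { s s' t t' a a' (⇓embF₁ d) → ⇓embF₁ (fails s t a d)
      ; s s' t t' a a' (⇓embF₂ d d') → ⇓embF₂ (proj₁ (proj₂ (run s t _ a d))) (fails' s' t' a' d') }

bassert-⊩B : ∀ {vs vs' P} → (vs , vs') ⊩R² P → (vs , vs') ⊩B bassert P ⇒ (vs , vs')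
bassert-⊩B fP =
  (λ { s s' t t' _ _ a a' (⇓bassert p) → t , t' , ⇓bassert (proj₁ (fP s s' t t' a a') p) , a , a' })
  , λ { s s' t t' a a' (⇓bassertF ¬p) → ⇓bassertF (¬p ∘ proj₂ (fP s s' t t' a a')) }

havf-⊩B : ∀ {vs vs' x P} → (vs , x ∷ vs') ⊩R² P → (vs , vs') ⊩B havf x P ⇒ (vs , x ∷ vs')
havf-⊩B {x = x} fP =
  (λ { s s' t t' _ _ a a' (⇓havf n p) →
         let a″ = update-=[] s' t' x refl a'
         in t , t' [ x ↦ n ] , ⇓havf n (proj₁ (fP s _ t _ a a″) p) , a , a″ })
  , λ { _ _ _ _ _ _ () }

⨟-⊩B : ∀ {vs vs' ws ws' us us' B₁ B₂} → (vs , vs') ⊩B B₁ ⇒ (ws , ws') →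
       (ws , ws') ⊩B B₂ ⇒ (us , us') → (vs , vs') ⊩B (B₁ ⨟ B₂) ⇒ (us , us')
⨟-⊩B {vs} {vs'} {ws} {ws'} {us} {us'} {B₁} {B₂} (run₁ , fails₁) (run₂ , fails₂) = run , fails
  where
  run : ∀ s s' t t' u u' → s =[ vs ] t → s' =[ vs' ] t' → (B₁ ⨟ B₂) / s ∥ s' ⇓ ok₂ u u' →
     ∃ λ v → ∃ λ v' → (B₁ ⨟ B₂) / t ∥ t' ⇓ ok₂ v v' × u =[ us ] v × u' =[ us' ] v'
  run s s' t t' u u' a a' (⇓bseq d₁ d₂) with run₁ s s' t t' _ _ a a' d₁
  ... | w , w' , d₁' , b , b' with run₂ _ _ w w' u u' b b' d₂
  ... | v , v' , d₂' , c , c' = v , v' , ⇓bseq d₁' d₂' , c , c'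
  fails : ∀ s s' t t' → s =[ vs ] t → s' =[ vs' ] t' → (B₁ ⨟ B₂) / s ∥ s' ⇓ fail →
          (B₁ ⨟ B₂) / t ∥ t' ⇓ fail
  fails s s' t t' a a' (⇓bseq d₁ d₂) with run₁ s s' t t' _ _ a a' d₁
  ... | w , w' , d₁' , b , b' = ⇓bseq d₁' (fails₂ _ _ w w' b b' d₂)
  fails s s' t t' a a' (⇓bseqF d) = ⇓bseqF (fails₁ s s' t t' a a' d)

bif-⊩B : ∀ {vs vs' ws ws' e e' B₁ B₂ B₃ B₄} → vs ⊩e e → vs' ⊩e e' →
         (vs , vs') ⊩B B₁ ⇒ (ws , ws') → (vs , vs') ⊩B B₂ ⇒ (ws , ws') →
         (vs , vs') ⊩B B₃ ⇒ (ws , ws') → (vs , vs') ⊩B B₄ ⇒ (ws , ws') →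
         (vs , vs') ⊩B bif e e' B₁ B₂ B₃ B₄ ⇒ (ws , ws')
bif-⊩B fe fe' (run₁ , fails₁) (run₂ , fails₂) (run₃ , fails₃) (run₄ , fails₄) = run , fails
  where
  run : ∀ s s' t t' u u' → s =[ _ ] t → s' =[ _ ] t' → _ / s ∥ s' ⇓ ok₂ u u' →
     ∃ λ v → ∃ λ v' → _ / t ∥ t' ⇓ ok₂ v v' × u =[ _ ] v × u' =[ _ ] v'
  run s s' t t' u u' a a' (⇓bifTT es es' d) =
    map₂ (map₂ (map₁ (⇓bifTT (⊩e-transfer fe a es) (⊩e-transfer fe' a' es')))) (run₁ s s' t t' u u' a a' d)
  run s s' t t' u u' a a' (⇓bifTF es es' d) =
    map₂ (map₂ (map₁ (⇓bifTF (⊩e-transfer fe a es) (⊩e-transfer fe' a' es')))) (run₂ s s' t t' u u' a a' d)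
  run s s' t t' u u' a a' (⇓bifFT es es' d) =
    map₂ (map₂ (map₁ (⇓bifFT (⊩e-transfer fe a es) (⊩e-transfer fe' a' es')))) (run₃ s s' t t' u u' a a' d)
  run s s' t t' u u' a a' (⇓bifFF es es' d) =
    map₂ (map₂ (map₁ (⇓bifFF (⊩e-transfer fe a es) (⊩e-transfer fe' a' es')))) (run₄ s s' t t' u u' a a' d)
  fails : ∀ s s' t t' → s =[ _ ] t → s' =[ _ ] t' → _ / s ∥ s' ⇓ fail → _ / t ∥ t' ⇓ fail
  fails s s' t t' a a' (⇓bifTT es es' d) =
    ⇓bifTT (⊩e-transfer fe a es) (⊩e-transfer fe' a' es') (fails₁ s s' t t' a a' d)
  fails s s' t t' a a' (⇓bifTF es es' d) =
    ⇓bifTF (⊩e-transfer fe a es) (⊩e-transfer fe' a' es') (fails₂ s s' t t' a a' d)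
  fails s s' t t' a a' (⇓bifFT es es' d) =
    ⇓bifFT (⊩e-transfer fe a es) (⊩e-transfer fe' a' es') (fails₃ s s' t t' a a' d)
  fails s s' t t' a a' (⇓bifFF es es' d) =
    ⇓bifFF (⊩e-transfer fe a es) (⊩e-transfer fe' a' es') (fails₄ s s' t t' a a' d)

module _ {vs : List Var} {e e' : BExp} {𝓛 𝓡 : Rel} {E : Exp2} {B : Bicom}
         (fe : vs ⊩e e) (fe' : vs ⊩e e') (f𝓛 : vs ⊩R 𝓛) (f𝓡 : vs ⊩R 𝓡)
         (fB : vs ⊩B B) (fBL : vs ⊩B biL B) (fBR : vs ⊩B biR B) where

  private
    W : Bicom
    W = bwhile e e' 𝓛 𝓡 E B

    module _ {s s' t t'} (a : s =[ vs ] t) (a' : s' =[ vs ] t') where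
      guard : ∀ {b} → e s ≡ b → e t ≡ b
      guard = ⊩e-transfer fe a
      guard' : ∀ {b} → e' s' ≡ b → e' t' ≡ b
      guard' = ⊩e-transfer fe' a'
      left : 𝓛 s s' → 𝓛 t t'
      left = proj₁ (f𝓛 s s' t t' a a')
      ¬left : ¬ 𝓛 s s' → ¬ 𝓛 t t'
      ¬left ¬l = ¬l ∘ proj₂ (f𝓛 s s' t t' a a')
      right : 𝓡 s s' → 𝓡 t t'
      right = proj₁ (f𝓡 s s' t t' a a')
      ¬right : ¬ 𝓡 s s' → ¬ 𝓡 t t'
      ¬right ¬r = ¬r ∘ proj₂ (f𝓡 s s' t t' a a')
      ¬leftStep : ¬ (e s ≡ true × 𝓛 s s') → ¬ (e t ≡ true × 𝓛 t t')
      ¬leftStep ¬l (et , l) = ¬l (⊩e-transfer fe (=[]-sym a) et , proj₂ (f𝓛 s s' t t' a a') l)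

    run : ∀ s s' t t' u u' → s =[ vs ] t → s' =[ vs ] t' → W / s ∥ s' ⇓ ok₂ u u' →
       ∃ λ v → ∃ λ v' → W / t ∥ t' ⇓ ok₂ v v' × u =[ vs ] v × u' =[ vs ] v'
    run s s' t t' _ _ a a' (⇓bwStop es es') = t , t' , ⇓bwStop (guard a a' es) (guard' a a' es') , a , a'
    run s s' t t' u u' a a' (⇓bwL es l d dw) with proj₁ fBL s s' t t' _ _ a a' d
    ... | w , w' , d' , b , b' =
      map₂ (map₂ (map₁ (⇓bwL (guard a a' es) (left a a' l) d'))) (run _ _ w w' u u' b b' dw)
    run s s' t t' u u' a a' (⇓bwR ¬l es' r d dw) with proj₁ fBR s s' t t' _ _ a a' d
    ... | w , w' , d' , b , b' =
      map₂ (map₂ (map₁ (⇓bwR (¬leftStep a a' ¬l) (guard' a a' es') (right a a' r) d')))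
        (run _ _ w w' u u' b b' dw)
    run s s' t t' u u' a a' (⇓bwB es es' ¬l ¬r d dw) with proj₁ fB s s' t t' _ _ a a' d
    ... | w , w' , d' , b , b' =
      map₂ (map₂ (map₁ (⇓bwB (guard a a' es) (guard' a a' es') (¬left a a' ¬l) (¬right a a' ¬r) d')))
        (run _ _ w w' u u' b b' dw)

    fails : ∀ s s' t t' → s =[ vs ] t → s' =[ vs ] t' → W / s ∥ s' ⇓ fail → W / t ∥ t' ⇓ fail
    fails s s' t t' a a' (⇓bwL es l d dw) with proj₁ fBL s s' t t' _ _ a a' d
    ... | w , w' , d' , b , b' = ⇓bwL (guard a a' es) (left a a' l) d' (fails _ _ w w' b b' dw)
    fails s s' t t' a a' (⇓bwLF es l d) =
      ⇓bwLF (guard a a' es) (left a a' l) (proj₂ fBL s s' t t' a a' d)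
    fails s s' t t' a a' (⇓bwR ¬l es' r d dw) with proj₁ fBR s s' t t' _ _ a a' d
    ... | w , w' , d' , b , b' =
      ⇓bwR (¬leftStep a a' ¬l) (guard' a a' es') (right a a' r) d' (fails _ _ w w' b b' dw)
    fails s s' t t' a a' (⇓bwRF ¬l es' r d) =
      ⇓bwRF (¬leftStep a a' ¬l) (guard' a a' es') (right a a' r) (proj₂ fBR s s' t t' a a' d)
    fails s s' t t' a a' (⇓bwB es es' ¬l ¬r d dw) with proj₁ fB s s' t t' _ _ a a' d
    ... | w , w' , d' , b , b' =
      ⇓bwB (guard a a' es) (guard' a a' es') (¬left a a' ¬l) (¬right a a' ¬r) d' (fails _ _ w w' b b' dw)
    fails s s' t t' a a' (⇓bwBF es es' ¬l ¬r d) =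
      ⇓bwBF (guard a a' es) (guard' a a' es') (¬left a a' ¬l) (¬right a a' ¬r) (proj₂ fB s s' t t' a a' d)
    fails s s' t t' a a' (⇓bwXL es es' ¬l) = ⇓bwXL (guard a a' es) (guard' a a' es') (¬left a a' ¬l)
    fails s s' t t' a a' (⇓bwXR es es' ¬r) = ⇓bwXR (guard a a' es) (guard' a a' es') (¬right a a' ¬r)

  bwhile-⊩B : vs ⊩B bwhile e e' 𝓛 𝓡 E B
  bwhile-⊩B = run , fails

L-biR-⊩c : ∀ {vs} B → vs ⊩c L (biR B)
L-biR-⊩c ⟨ c ∣ c' ⟩ = skip-⊩c
L-biR-⊩c (bassert P) = skip-⊩c
L-biR-⊩c (havf x P) = skip-⊩c
L-biR-⊩c (B₁ ⨟ B₂) = ⨾-⊩c (L-biR-⊩c B₁) (L-biR-⊩c B₂)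
L-biR-⊩c (bif e e' B₁ B₂ B₃ B₄) = if-⊩c const-⊩e (L-biR-⊩c B₁) (L-biR-⊩c B₃)
L-biR-⊩c (bwhile e e' 𝓛 𝓡 E B) = while-⊩c const-⊩e (L-biR-⊩c B)

-- Definitionally the body that chk builds for a loop, with fresh name n.
chkBody : ℕ → BExp → Rel → Exp2 → Bicom → Bicom
chkBody n e' 𝓟' E X =
    havf (mkVar n int) (λ s s' → s' (mkVar n int) ≡ E s s')
  ⨟ havf (mkVar n bool) (λ s s' → (s' (mkVar n bool) ≡ true) iff (e' s' ≡ true × 𝓟' s s'))
  ⨟ X
  ⨟ bassert (λ s s' → s' (mkVar n bool) ≡ true → (+ 0 ≤ℤ E s s') × (E s s' <ℤ s' (mkVar n int)))

L-chk-⊩c : ∀ vs B → biFrame B vs → vs ⊩c L (chk B vs)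
L-chk-⊩c vs ⟨ c ∣ c' ⟩ (f , _) = cFrame⇒⊩c c f
L-chk-⊩c vs (bassert P) _ = skip-⊩c
L-chk-⊩c vs (havf x P) _ = ⨾-⊩c skip-⊩c skip-⊩c
L-chk-⊩c vs (B₁ ⨟ B₂) (f₁ , f₂) = ⨾-⊩c (L-chk-⊩c vs B₁ f₁) (L-chk-⊩c vs B₂ f₂)
L-chk-⊩c vs (bif e e' B₁ B₂ B₃ B₄) (fe , _ , f₁ , _ , f₃ , _) =
  if-⊩c fe (L-chk-⊩c vs B₁ f₁) (L-chk-⊩c vs B₃ f₃)
L-chk-⊩c vs (bwhile e e' 𝓛 𝓡 E B) (fe , _ , _ , _ , _ , f) =
  while-⊩c fe (⨾-⊩c skip-⊩c (⨾-⊩c skip-⊩c (⨾-⊩c (L-chk-⊩c vs B f) skip-⊩c)))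

chkBody-⊩B : ∀ {vs n e' 𝓟' E X} → vs ⊩e e' → vs ⊩R 𝓟' → vs ⊩E E → vs ⊩B X →
  mkVar n int ∉ modVarsR X → mkVar n bool ∉ modVarsR X → vs ⊩B chkBody n e' 𝓟' E X
chkBody-⊩B {vs} {n} {e'} {𝓟'} {E} fe' f𝓟' fE fX x₁∉ x₂∉ =
  ⊩B-weakenʳ (there ∘ there)
    (⨟-⊩B (havf-⊩B frame₁)
    (⨟-⊩B (havf-⊩B frame₂)
    (⨟-⊩B (⊩B-extendʳ (⊩B-extendʳ fX x₁∉) x₂∉)
          (bassert-⊩B frame₃))))
  where
  x₁ x₂ : Var
  x₁ = mkVar n int
  x₂ = mkVar n bool
  inner : ∀ {s t} → s =[ x₂ ∷ x₁ ∷ vs ] t → s =[ vs ] t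
  inner = =[]-⊆ (there ∘ there)
  frame₁ : (vs , x₁ ∷ vs) ⊩R² (λ s s' → s' x₁ ≡ E s s')
  frame₁ = ⊩R²-∘ {f = λ s s' → s' x₁ , E s s'} (λ (m , k) → m ≡ k) λ s s' t t' a a' →
    cong₂ _,_ (a' x₁ (here refl)) (fE s s' t t' a (=[]-∷⁻ a'))
  frame₂ : (vs , x₂ ∷ x₁ ∷ vs) ⊩R² (λ s s' → (s' x₂ ≡ true) iff (e' s' ≡ true × 𝓟' s s'))
  frame₂ s s' t t' a a' =
    iff-cong (≡-iff (a' x₂ (here refl)))
      (×-iff (≡-iff (fe' s' t' (inner a'))) (f𝓟' s s' t t' a (inner a')))
  bounded : Bool × ℤ × ℤ → Set
  bounded (b , m , k) = b ≡ true → (+ 0 ≤ℤ m) × (m <ℤ k)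
  frame₃ : (vs , x₂ ∷ x₁ ∷ vs) ⊩R² (λ s s' → s' x₂ ≡ true → (+ 0 ≤ℤ E s s') × (E s s' <ℤ s' x₁))
  frame₃ = ⊩R²-∘ {f = λ s s' → s' x₂ , E s s' , s' x₁} bounded λ s s' t t' a a' →
    cong₂ _,_ (a' x₂ (here refl)) (cong₂ _,_ (fE s s' t t' a (inner a')) (a' x₁ (there (here refl))))

havf-chk-⊩B : ∀ {vs x P} → vs ⊩R P → vs ⊩B (bassert (∃∣ x P) ⨟ havf x P)
havf-chk-⊩B {vs} {x} {P} fP =
  ⨟-⊩B (bassert-⊩B (∃∣-⊩R² fP′)) (⊩B-weakenʳ there (havf-⊩B fP′))
  where
  fP′ : (vs , x ∷ vs) ⊩R² P
  fP′ = ⊩R²-⊆ʳ there fP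

biR-chk-⊩B : ∀ vs B → biFrame B vs → vs ⊩B biR (chk B vs)
biR-chk-⊩B vs ⟨ c ∣ c' ⟩ (_ , f') = emb-⊩B skip-⊩c (uchk-⊩c vs c' f')
biR-chk-⊩B vs (bassert P) fP = bassert-⊩B fP
biR-chk-⊩B vs (havf x P) (_ , fP) = havf-chk-⊩B fP
biR-chk-⊩B vs (B₁ ⨟ B₂) (f₁ , f₂) = ⨟-⊩B (biR-chk-⊩B vs B₁ f₁) (biR-chk-⊩B vs B₂ f₂)
biR-chk-⊩B vs (bif e e' B₁ B₂ B₃ B₄) (_ , fe' , f₁ , f₂ , f₃ , f₄) =
  bif-⊩B const-⊩e fe' (biR-chk-⊩B vs B₁ f₁) (biR-chk-⊩B vs B₂ f₂)
    (biR-chk-⊩B vs B₃ f₃) (biR-chk-⊩B vs B₄ f₄)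
biR-chk-⊩B vs (bwhile e e' 𝓛 𝓡 E B) (_ , fe' , _ , f𝓡 , fE , f) =
  bwhile-⊩B const-⊩e fe' ∅R-⊩R f𝓡 body (emb-⊩B (L-biR-⊩c (chkBody n e' 𝓡 E (chk B vs))) skip-⊩c)
    (subst (vs ⊩B_) (sym (biR-idem (chkBody n e' 𝓡 E (chk B vs)))) body)
  where
  n : ℕ
  n = freshName (vs ++ modVarsR (chk B vs))
  body : vs ⊩B chkBody n e' 𝓡 E (biR (chk B vs))
  body = chkBody-⊩B fe' f𝓡 fE (biR-chk-⊩B vs B f)
           (freshName-∉-biR vs (chk B vs) int) (freshName-∉-biR vs (chk B vs) bool)

chk-⊩B : ∀ vs B → biFrame B vs → vs ⊩B chk B vs
chk-⊩B vs ⟨ c ∣ c' ⟩ (f , f') = emb-⊩B (cFrame⇒⊩c c f) (uchk-⊩c vs c' f')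
chk-⊩B vs (bassert P) fP = bassert-⊩B fP
chk-⊩B vs (havf x P) (_ , fP) = havf-chk-⊩B fP
chk-⊩B vs (B₁ ⨟ B₂) (f₁ , f₂) = ⨟-⊩B (chk-⊩B vs B₁ f₁) (chk-⊩B vs B₂ f₂)
chk-⊩B vs (bif e e' B₁ B₂ B₃ B₄) (fe , fe' , f₁ , f₂ , f₃ , f₄) =
  bif-⊩B fe fe' (chk-⊩B vs B₁ f₁) (chk-⊩B vs B₂ f₂) (chk-⊩B vs B₃ f₃) (chk-⊩B vs B₄ f₄)
chk-⊩B vs (bwhile e e' 𝓛 𝓡 E B) (fe , fe' , f𝓛 , f𝓡 , fE , f) =
  bwhile-⊩B fe fe' f𝓛 f𝓡
    (chkBody-⊩B fe' f𝓡 fE (chk-⊩B vs B f) (freshName-∉ʳ vs _ int) (freshName-∉ʳ vs _ bool))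
    (emb-⊩B (⨾-⊩c skip-⊩c (⨾-⊩c skip-⊩c (⨾-⊩c (L-chk-⊩c vs B f) skip-⊩c))) skip-⊩c)
    (chkBody-⊩B fe' f𝓡 fE (biR-chk-⊩B vs B f)
       (freshName-∉-biR vs (chk B vs) int) (freshName-∉-biR vs (chk B vs) bool))

lemma5p2 : (vs : List Var) →
    ((c : Cmd) → cFrame c vs → vs ⊩c uchk c vs)
    × ((B : Bicom) → biFrame B vs → vs ⊩B biR (chk B vs))
    × ((B : Bicom) → biFrame B vs → vs ⊩B chk B vs)
lemma5p2 vs = uchk-⊩c vs , biR-chk-⊩B vs , chk-⊩B vs
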